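{- Let $(G,k)$ be an instance of \textsc{$\mathcal{F}$-Deletion} where $G$ is non-cascading, and let $X$ be the set of conflict edges of $G$. If $\tilde S$ is a set of edges such that every induced subgraph of $G$ isomorphic to some $F\in\mathcal{F}$ is not an induced subgraph of $G-\tilde S$, then $S:=\tilde S\cap X$ is a set of edges such that $G-S$ has no induced subgraph isomorphic to any $F\in\mathcal{F}$.
   Context: Graphs are edge-colored: $E=E_1\sqcup\dots\sqcup E_c$. $\mathcal{F}$ is a set of $c$-colored graphs; isomorphism preserves adjacency and edge colors. \textsc{$\mathcal{F}$-Deletion}: given $G$ and integer $k$, decide whether some set $S$ of at most $k$ edges makes $G-S$ contain no induced subgraph isomorphic to any $F\in\mathcal{F}$. An edge $e$ of $G$ is a conflict edge if $e$ lies in some induced subgraph of $G$ isomorphic to some $F\in\mathcal{F}$. Let $X$ be the set of conflict edges. $G$ is non-cascading if for every subgraph $H$ of $G$ that is isomorphic to some $F\in\mathcal{F}$ but is not an induced subgraph of $G$, and for every $X'\subseteq X$, $H$ is not an induced subgraph of $G-X'$. -}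

module Defs where

open import Level using (Level; suc; _⊔_) renaming (zero to lzero)
open import Data.Nat using (ℕ)
open import Data.Fin using (Fin)
open import Data.Maybe using (Maybe; just; nothing)
open import Data.Product using (Σ; ∃; ∃-syntax; _×_; _,_)
open import Data.Sum using (_⊎_)
open import Relation.Nullary using (¬_)
open import Relation.Binary.PropositionalEquality using (_≡_)
open import Function.Definitions using (Injective)

-- A finite simple graph on vertex set Fin n whose edges are colored with
-- colors from Fin c.  adj i j = nothing : no edge; adj i j = just a : edge {i,j} of color a.
record Graph (n c : ℕ) : Set where
  field
    adj    : Fin n → Fin n → Maybe (Fin c)
    sym    : ∀ i j → adj i j ≡ adj j i
    irrefl : ∀ i → adj i i ≡ nothing
open Graph public

Family : ℕ → Set₁
Family c = (m : ℕ) → Graph m c → Set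

-- A set of edges on vertex set Fin n: a predicate on ordered pairs, where the
-- pair (i , j) stands for the unordered pair {i , j}.
EdgeSet : ℕ → Set₁
EdgeSet n = Fin n → Fin n → Set

_∈ₑ_ : ∀ {n} → Fin n × Fin n → EdgeSet n → Set
(i , j) ∈ₑ S = S i j ⊎ S j i

IsEdgeSetOf : ∀ {n c} → EdgeSet n → Graph n c → Set
IsEdgeSetOf {n} {c} S G = ∀ (i j : Fin n) → S i j → ∃[ a ] (adj G i j ≡ just a)

_⊆ₑ_ : ∀ {n} → EdgeSet n → EdgeSet n → Set
S ⊆ₑ T = ∀ i j → S i j → T i j

_∩ₑ_ : ∀ {n} → EdgeSet n → EdgeSet n → EdgeSet n
(S ∩ₑ T) i j = S i j × T i j

-- Colored adjacency "relation": R i j x says the (colored) adjacency of {i,j} is x.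
AdjRel : ℕ → ℕ → Set₁
AdjRel n c = Fin n → Fin n → Maybe (Fin c) → Set

adjRel : ∀ {n c} → Graph n c → AdjRel n c
adjRel G i j x = adj G i j ≡ x

delRel : ∀ {n c} → Graph n c → EdgeSet n → AdjRel n c
delRel G S i j (just a) = (adj G i j ≡ just a) × ¬ ((i , j) ∈ₑ S)
delRel G S i j nothing  = (adj G i j ≡ nothing) ⊎ ((i , j) ∈ₑ S)

-- φ maps F isomorphically onto the subgraph of the host (with adjacency R)
-- induced by the image of φ: i.e. φ is an induced, color-preserving embedding.
InducedVia : ∀ {m n c} → AdjRel n c → Graph m c → (Fin m → Fin n) → Set
InducedVia R F φ = ∀ u v → R (φ u) (φ v) (adj F u v)

-- φ maps F isomorphically onto a (not necessarily induced) subgraph H of G: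
-- H has vertex set image φ and edge set φ(E(F)) with the colors of F,
-- and every edge of H is an edge of G of the same color.
SubgraphVia : ∀ {m n c} → Graph n c → Graph m c → (Fin m → Fin n) → Set
SubgraphVia G F φ = ∀ u v a → adj F u v ≡ just a → adj G (φ u) (φ v) ≡ just a

-- Conflict edges of G w.r.t. 𝓕: edges of G lying in some induced subgraph of G
-- isomorphic to some F ∈ 𝓕.
Conflict : ∀ {n c} → Family c → Graph n c → EdgeSet n
Conflict {n} {c} 𝓕 G i j =
  (∃[ a ] (adj G i j ≡ just a)) ×
  Σ ℕ λ m → Σ (Graph m c) λ F → 𝓕 m F × Σ (Fin m → Fin n) λ φ →
    Injective _≡_ _≡_ φ × InducedVia (adjRel G) F φ ×
    Σ (Fin m) λ u → Σ (Fin m) λ v → (φ u ≡ i) × (φ v ≡ j)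

NonCascading : ∀ {n c} → Family c → Graph n c → Set₁
NonCascading {n} {c} 𝓕 G =
  ∀ (m : ℕ) (F : Graph m c) → 𝓕 m F →
  ∀ (φ : Fin m → Fin n) → Injective _≡_ _≡_ φ →
  SubgraphVia G F φ → ¬ InducedVia (adjRel G) F φ →
  ∀ (X' : EdgeSet n) → X' ⊆ₑ Conflict 𝓕 G →
  ¬ InducedVia (delRel G X') F φ

HitsAll : ∀ {n c} → Family c → Graph n c → EdgeSet n → Set
HitsAll {n} {c} 𝓕 G S =
  ∀ (m : ℕ) (F : Graph m c) → 𝓕 m F →
  ∀ (φ : Fin m → Fin n) → Injective _≡_ _≡_ φ →
  InducedVia (adjRel G) F φ → ¬ InducedVia (delRel G S) F φ

FFree : ∀ {n c} → Family c → Graph n c → EdgeSet n → Set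
FFree {n} {c} 𝓕 G S =
  ∀ (m : ℕ) (F : Graph m c) → 𝓕 m F →
  ∀ (φ : Fin m → Fin n) → Injective _≡_ _≡_ φ →
  ¬ InducedVia (delRel G S) F φ

{-# OPTIONS --safe #-}
-- Suppose φ embeds some F ∈ 𝓕 as an induced subgraph of G − S, where S = S̃ ∩ X.
-- Deleting edges never creates edges, so φ embeds F as a subgraph of G.  If φ were
-- induced in G, every edge of its image would be a conflict edge, so S̃ and S would
-- delete the same edges of the image and φ would be induced in G − S̃ as well,
-- contradicting the choice of S̃.  Hence φ is a non-induced copy of F in G that
-- becomes induced after deleting S ⊆ X, which non-cascading forbids.
module Submission where

open import Defs
open import Data.Nat using (ℕ)
open import Data.Fin using (Fin)
open import Data.Maybe using (just; nothing)
open import Data.Product using (_,_; proj₂)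
open import Data.Sum using (inj₁; inj₂)
open import Relation.Nullary using (¬_)
open import Function.Definitions using (Injective)
open import Relation.Binary.PropositionalEquality using (_≡_; refl; subst)

module _ {n c : ℕ} (G : Graph n c) where

  induced-del⇒subgraph : ∀ {m} {F : Graph m c} {φ : Fin m → Fin n} {S : EdgeSet n} →
    InducedVia (delRel G S) F φ → SubgraphVia G F φ
  induced-del⇒subgraph {F = F} {φ} ind u v a Fuv≡a
    with adj F u v | ind u v
  induced-del⇒subgraph ind u v a refl | just .a | (Gφuv≡a , _) = Gφuv≡a

  induced⇒image-edges-conflict : ∀ (𝓕 : Family c) {m} {F : Graph m c} {φ : Fin m → Fin n} →
    𝓕 m F → Injective _≡_ _≡_ φ → InducedVia (adjRel G) F φ →
    ∀ u v a → adj F u v ≡ just a → Conflict 𝓕 G (φ u) (φ v)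
  induced⇒image-edges-conflict 𝓕 {m} {F} {φ} F∈𝓕 inj ind u v a Fuv≡a =
    (a , subst (λ x → adj G (φ u) (φ v) ≡ x) Fuv≡a (ind u v)) ,
    m , F , F∈𝓕 , φ , inj , ind , u , v , refl , refl

  induced-del-∩⇒induced-del : ∀ {m} {F : Graph m c} {φ : Fin m → Fin n} {S̃ T : EdgeSet n} →
    (∀ u v a → adj F u v ≡ just a → T (φ u) (φ v)) →
    InducedVia (adjRel G) F φ → InducedVia (delRel G (S̃ ∩ₑ T)) F φ →
    InducedVia (delRel G S̃) F φ
  induced-del-∩⇒induced-del {F = F} {φ} {S̃} image⊆T ind ind∩ u v
    with adj F u v in Fuv | ind u v | ind∩ u v
  ... | nothing | Gφuv≡nothing | _ = inj₁ Gφuv≡nothing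
  ... | just a  | _ | (Gφuv≡a , φuv∉S̃∩T) = Gφuv≡a , φuv∉S̃
    where
    Fvu : adj F v u ≡ just a
    Fvu = subst (λ x → x ≡ just a) (Graph.sym F u v) Fuv

    φuv∉S̃ : ¬ ((φ u , φ v) ∈ₑ S̃)
    φuv∉S̃ (inj₁ s) = φuv∉S̃∩T (inj₁ (s , image⊆T u v a Fuv))
    φuv∉S̃ (inj₂ s) = φuv∉S̃∩T (inj₂ (s , image⊆T v u a Fvu))

proposition2 : ∀ {n c : ℕ} (𝓕 : Family c) (G : Graph n c) (k : ℕ) →
    NonCascading 𝓕 G →
    ∀ (S̃ : EdgeSet n) → IsEdgeSetOf S̃ G → HitsAll 𝓕 G S̃ →
    FFree 𝓕 G (S̃ ∩ₑ Conflict 𝓕 G)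
proposition2 𝓕 G k nonCascading S̃ _ hitsAll m F F∈𝓕 φ inj inducedInG−S =
  nonCascading m F F∈𝓕 φ inj
    (induced-del⇒subgraph G {F = F} {φ} {S̃ ∩ₑ Conflict 𝓕 G} inducedInG−S) notInducedInG
    (S̃ ∩ₑ Conflict 𝓕 G) (λ _ _ → proj₂) inducedInG−S
  where
  notInducedInG : ¬ InducedVia (adjRel G) F φ
  notInducedInG ind =
    hitsAll m F F∈𝓕 φ inj ind
      (induced-del-∩⇒induced-del G {F = F} {φ} {S̃} {Conflict 𝓕 G}
        (induced⇒image-edges-conflict G 𝓕 F∈𝓕 inj ind) ind inducedInG−S)
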